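{- Let $F_2$ be the free group on two generators and for each positive integer $n$ let $$M_n = \sup_{A \subseteq F_2,\ |A| = n} \bigl|\,|AA^{ -1}| - |A^{ -1}A|\,\bigr|.$$ Then $M_n = \Theta(n^2)$ as $n \to \infty$.
   Context: For a finite subset $A$ of a group $G$, the right quotient set is $AA^{ -1} = \{a b^{ -1} : a, b \in A\}$ and the left quotient set is $A^{ -1}A = \{a^{ -1} b : a, b \in A\}$. -}

module Defs where

open import Data.Nat using (ℕ; _≤_; _*_; _^_; ∣_-_∣)
open import Data.Fin using (Fin)
import Data.Fin.Properties as FinP
open import Data.Bool using (Bool; not; if_then_else_)
import Data.Bool.Properties as BoolP
open import Data.Product using (_×_; _,_)
import Data.Product.Properties as ProdP
open import Data.List using (List; []; _∷_; _++_; map; reverse; foldr; length; deduplicate; cartesianProductWith)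
import Data.List.Properties as ListP
open import Data.List.Relation.Unary.All using (All)
open import Data.List.Relation.Unary.Unique.Propositional using (Unique)
open import Data.Unit using (⊤)
open import Relation.Binary.PropositionalEquality using (_≡_; _≢_)
open import Relation.Binary.Definitions using (DecidableEquality)
open import Relation.Nullary.Decidable using (⌊_⌋)

-- Letters of the free group F₂ on generators 0,1: (generator , true) = g, (generator , false) = g⁻¹.
Letter : Set
Letter = Fin 2 × Bool

invL : Letter → Letter
invL (g , s) = (g , not s)

_≟L_ : DecidableEquality Letter
_≟L_ = ProdP.≡-dec FinP._≟_ BoolP._≟_

_≟W_ : DecidableEquality (List Letter)
_≟W_ = ListP.≡-dec _≟L_

Reduced : List Letter → Set
Reduced []            = ⊤
Reduced (x ∷ [])      = ⊤
Reduced (x ∷ y ∷ w)   = (y ≢ invL x) × Reduced (y ∷ w)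

-- Elements of F₂ are reduced words. Free reduction of an arbitrary word:
push : Letter → List Letter → List Letter
push x []      = x ∷ []
push x (y ∷ w) = if ⌊ y ≟L invL x ⌋ then w else (x ∷ y ∷ w)

reduce : List Letter → List Letter
reduce = foldr push []

mul : List Letter → List Letter → List Letter
mul u v = reduce (u ++ v)

inv : List Letter → List Letter
inv w = reverse (map invL w)

record FinSubset (n : ℕ) : Set where
  field
    elems   : List (List Letter)
    reduced : All Reduced elems
    unique  : Unique elems
    size    : length elems ≡ n

card : List (List Letter) → ℕ
card xs = length (deduplicate _≟W_ xs)

rightQuot : List (List Letter) → ℕ
rightQuot A = card (cartesianProductWith (λ a b → mul a (inv b)) A A)

leftQuot : List (List Letter) → ℕ
leftQuot A = card (cartesianProductWith (λ a b → mul (inv a) b) A A)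

quotDiff : ∀ {n} → FinSubset n → ℕ
quotDiff A = ∣ rightQuot (FinSubset.elems A) - leftQuot (FinSubset.elems A) ∣

IsSupQuotDiff : ℕ → ℕ → Set
IsSupQuotDiff n m =
  ((A : FinSubset n) → quotDiff A ≤ m) ×
  ((b : ℕ) → ((A : FinSubset n) → quotDiff A ≤ b) → m ≤ b)

module Submission where

-- Take A = {aⁱ : i < k} ∪ {b aʲ : j < m} with k, m ≈ n/2. The k·m reduced words a⁻ⁱ b aʲ are
-- distinct elements of A⁻¹A, whereas every element of AA⁻¹ freely reduces to u aᵈ v⁻¹ with
-- u, v ∈ {1, b} and |d| < n, so |AA⁻¹| ≤ 8n. Hence the difference is at least n²/4 − 8n, and it
-- is at most n² since both quotient sets have at most n² elements.

open import Defs
open import Data.Nat using (ℕ; zero; suc; _+_; _∸_; _*_; _^_; _≤_; _<_; z≤n; s≤s; NonZero; >-nonZero; ∣_-_∣; ⌊_/2⌋; ⌈_/2⌉)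
open import Data.Nat.Properties
open import Data.Nat.Tactic.RingSolver using (solve-∀)
open import Data.Fin using (Fin; zero; suc)
import Data.Fin.Properties as FinP
open import Data.Bool using (true; false)
open import Data.Product using (_×_; _,_; proj₁; proj₂; ∃-syntax)
open import Data.Sum using (inj₁; inj₂)
open import Data.List using (List; []; _∷_; _++_; _∷ʳ_; map; reverse; replicate; length; lookup; upTo; deduplicate; cartesianProduct; cartesianProductWith)
import Data.List.Properties as ListP
open import Data.List.Membership.Propositional using (_∈_)
open import Data.List.Membership.Propositional.Properties
open import Data.List.Relation.Binary.Subset.Propositional using (_⊆_)
import Data.List.Relation.Unary.Any as Any
open import Data.List.Relation.Unary.Any.Properties using (lookup-index)
open import Data.List.Relation.Unary.All as All using (All)
import Data.List.Relation.Unary.All.Properties as AllP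
open import Data.List.Relation.Unary.Unique.Propositional using (Unique; _∷_)
import Data.List.Relation.Unary.Unique.Propositional.Properties as Unique
open import Data.List.Relation.Unary.Unique.DecPropositional.Properties using (deduplicate-!)
open import Data.Unit using (tt)
open import Data.Empty using (⊥-elim)
open import Function.Definitions using (Injective)
open import Relation.Binary.Definitions using (DecidableEquality)
open import Relation.Binary.PropositionalEquality
open import Relation.Nullary using (¬_; yes; no)

module _ {A : Set} where

  lookup-injective : ∀ {xs : List A} → Unique xs → ∀ {i j} → lookup xs i ≡ lookup xs j → i ≡ j
  lookup-injective (_ ∷ _)   {zero}  {zero}  _  = refl
  lookup-injective (x∉ ∷ _)  {zero}  {suc j} eq = ⊥-elim (All.lookup x∉ (∈-lookup j) eq)
  lookup-injective (x∉ ∷ _)  {suc i} {zero}  eq = ⊥-elim (All.lookup x∉ (∈-lookup i) (sym eq))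
  lookup-injective (_ ∷ xs!) {suc i} {suc j} eq = cong suc (lookup-injective xs! eq)

  Unique-⊆⇒length≤ : ∀ {xs ys : List A} → Unique xs → xs ⊆ ys → length xs ≤ length ys
  Unique-⊆⇒length≤ {xs} {ys} xs! xs⊆ys = FinP.injective⇒≤ position-injective
    where
    position : Fin (length xs) → Fin (length ys)
    position i = Any.index (xs⊆ys (∈-lookup i))

    position-injective : Injective _≡_ _≡_ position
    position-injective {i} {j} eq = lookup-injective xs! (begin
      lookup xs i            ≡⟨ lookup-index (xs⊆ys (∈-lookup i)) ⟩
      lookup ys (position i) ≡⟨ cong (lookup ys) eq ⟩
      lookup ys (position j) ≡⟨ lookup-index (xs⊆ys (∈-lookup j)) ⟨
      lookup xs j            ∎)
      where open ≡-Reasoning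

  module _ (_≟_ : DecidableEquality A) where

    length-deduplicate-⊆ : ∀ {xs ys} → xs ⊆ ys → length (deduplicate _≟_ xs) ≤ length ys
    length-deduplicate-⊆ {xs} xs⊆ys =
      Unique-⊆⇒length≤ (deduplicate-! _≟_ xs) (λ x∈ → xs⊆ys (∈-deduplicate⁻ _≟_ xs x∈))

    Unique-⊆⇒length≤deduplicate : ∀ {xs ys} → Unique xs → xs ⊆ ys → length xs ≤ length (deduplicate _≟_ ys)
    Unique-⊆⇒length≤deduplicate xs! xs⊆ys = Unique-⊆⇒length≤ xs! (λ x∈ → ∈-deduplicate⁺ _≟_ (xs⊆ys x∈))

  length-cartesianProductWith : ∀ {B C : Set} (f : A → B → C) xs ys →
                                length (cartesianProductWith f xs ys) ≡ length xs * length ys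
  length-cartesianProductWith f []       ys = refl
  length-cartesianProductWith f (x ∷ xs) ys = begin
    length (map (f x) ys ++ cartesianProductWith f xs ys)          ≡⟨ ListP.length-++ (map (f x) ys) ⟩
    length (map (f x) ys) + length (cartesianProductWith f xs ys)  ≡⟨ cong₂ _+_ (ListP.length-map (f x) ys) (length-cartesianProductWith f xs ys) ⟩
    length ys + length xs * length ys                              ∎
    where open ≡-Reasoning

invL-involutive : ∀ x → invL (invL x) ≡ x
invL-involutive (g , true)  = refl
invL-involutive (g , false) = refl

x≢invL-x : ∀ x → x ≢ invL x
x≢invL-x (g , true)  ()
x≢invL-x (g , false) ()

Reduced-tail : ∀ x w → Reduced (x ∷ w) → Reduced w
Reduced-tail x []      _       = tt
Reduced-tail x (y ∷ w) (_ , r) = r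

push-reduced : ∀ x w → Reduced w → Reduced (push x w)
push-reduced x []      _ = tt
push-reduced x (y ∷ w) r with y ≟L invL x
... | yes _   = Reduced-tail y w r
... | no  y≢x = y≢x , r

reduce-reduced : ∀ w → Reduced (reduce w)
reduce-reduced []      = tt
reduce-reduced (x ∷ w) = push-reduced x (reduce w) (reduce-reduced w)

push-reduced-id : ∀ x w → Reduced (x ∷ w) → push x w ≡ x ∷ w
push-reduced-id x []      _         = refl
push-reduced-id x (y ∷ w) (y≢x , _) with y ≟L invL x
... | yes y≡x = ⊥-elim (y≢x y≡x)
... | no  _   = refl

reduce-reduced-id : ∀ w → Reduced w → reduce w ≡ w
reduce-reduced-id []      _ = refl
reduce-reduced-id (x ∷ w) r =
  trans (cong (push x) (reduce-reduced-id w (Reduced-tail x w r))) (push-reduced-id x w r)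

push-invL-cancel : ∀ x w → Reduced w → push x (push (invL x) w) ≡ w
push-invL-cancel x [] _ with invL x ≟L invL x
... | yes _ = refl
... | no ¬p = ⊥-elim (¬p refl)
push-invL-cancel x (y ∷ w) r with y ≟L invL (invL x)
push-invL-cancel x (y ∷ [])    _         | yes y≡x = cong (_∷ []) (sym (trans y≡x (invL-involutive x)))
push-invL-cancel x (y ∷ z ∷ w) (z≢y , _) | yes y≡x with z ≟L invL x
... | yes z≡x⁻ = ⊥-elim (z≢y (trans z≡x⁻ (cong invL (sym (trans y≡x (invL-involutive x))))))
... | no  _    = cong (λ t → t ∷ z ∷ w) (sym (trans y≡x (invL-involutive x)))
push-invL-cancel x (y ∷ w) _ | no _ with invL x ≟L invL x
... | yes _ = refl
... | no ¬p = ⊥-elim (¬p refl)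

reduce-cancel-pair : ∀ x w → reduce (x ∷ invL x ∷ w) ≡ reduce w
reduce-cancel-pair x w = push-invL-cancel x (reduce w) (reduce-reduced w)

reduce-++-congʳ : ∀ u {v v'} → reduce v ≡ reduce v' → reduce (u ++ v) ≡ reduce (u ++ v')
reduce-++-congʳ []      eq = eq
reduce-++-congʳ (x ∷ u) eq = cong (push x) (reduce-++-congʳ u eq)

replicate-suc-∷ʳ : ∀ {A : Set} n (x : A) → replicate (suc n) x ≡ replicate n x ∷ʳ x
replicate-suc-∷ʳ zero    x = refl
replicate-suc-∷ʳ (suc n) x = cong (x ∷_) (replicate-suc-∷ʳ n x)

-- Truncated subtraction makes one of the two exponents 0, so the right-hand side is x^(i - j).
reduce-powers : ∀ x i j w →
  reduce (replicate i x ++ replicate j (invL x) ++ w) ≡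
  reduce (replicate (i ∸ j) x ++ replicate (j ∸ i) (invL x) ++ w)
reduce-powers x zero    zero    w = refl
reduce-powers x zero    (suc j) w = refl
reduce-powers x (suc i) zero    w = refl
reduce-powers x (suc i) (suc j) w = begin
  reduce (replicate (suc i) x ++ invL x ∷ replicate j (invL x) ++ w)
    ≡⟨ cong (λ t → reduce (t ++ invL x ∷ replicate j (invL x) ++ w)) (replicate-suc-∷ʳ i x) ⟩
  reduce ((replicate i x ∷ʳ x) ++ invL x ∷ replicate j (invL x) ++ w)
    ≡⟨ cong reduce (ListP.++-assoc (replicate i x) (x ∷ []) _) ⟩
  reduce (replicate i x ++ x ∷ invL x ∷ replicate j (invL x) ++ w)
    ≡⟨ reduce-++-congʳ (replicate i x) (reduce-cancel-pair x (replicate j (invL x) ++ w)) ⟩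
  reduce (replicate i x ++ replicate j (invL x) ++ w)
    ≡⟨ reduce-powers x i j w ⟩
  reduce (replicate (i ∸ j) x ++ replicate (j ∸ i) (invL x) ++ w) ∎
  where open ≡-Reasoning

reverse-replicate : ∀ {A : Set} n (x : A) → reverse (replicate n x) ≡ replicate n x
reverse-replicate zero    x = refl
reverse-replicate (suc n) x = begin
  reverse (x ∷ replicate n x)  ≡⟨ ListP.unfold-reverse x (replicate n x) ⟩
  reverse (replicate n x) ∷ʳ x ≡⟨ cong (_∷ʳ x) (reverse-replicate n x) ⟩
  replicate n x ∷ʳ x           ≡⟨ replicate-suc-∷ʳ n x ⟨
  replicate (suc n) x          ∎
  where open ≡-Reasoning

inv-++ : ∀ u v → inv (u ++ v) ≡ inv v ++ inv u
inv-++ u v = trans (cong reverse (ListP.map-++ invL u v)) (ListP.reverse-++ (map invL u) (map invL v))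

inv-replicate : ∀ n x → inv (replicate n x) ≡ replicate n (invL x)
inv-replicate n x = trans (cong reverse (ListP.map-replicate invL n x)) (reverse-replicate n (invL x))

replicate-injective : ∀ {A : Set} {i j} (x : A) → replicate i x ≡ replicate j x → i ≡ j
replicate-injective {i = i} {j} x eq =
  trans (sym (ListP.length-replicate i)) (trans (cong length eq) (ListP.length-replicate j))

replicate-++-injective : ∀ {A : Set} {x y : A} {w w'} i i' → y ≢ x →
  replicate i x ++ y ∷ w ≡ replicate i' x ++ y ∷ w' → i ≡ i' × w ≡ w'
replicate-++-injective zero    zero     _   eq = refl , ListP.∷-injectiveʳ eq
replicate-++-injective zero    (suc i') y≢x eq = ⊥-elim (y≢x (ListP.∷-injectiveˡ eq))
replicate-++-injective (suc i) zero     y≢x eq = ⊥-elim (y≢x (sym (ListP.∷-injectiveˡ eq)))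
replicate-++-injective (suc i) (suc i') y≢x eq with replicate-++-injective i i' y≢x (ListP.∷-injectiveʳ eq)
... | i≡i' , w≡w' = cong suc i≡i' , w≡w'

replicate-reduced : ∀ {x} n → Reduced (replicate n x)
replicate-reduced         zero          = tt
replicate-reduced         (suc zero)    = tt
replicate-reduced {x = x} (suc (suc n)) = x≢invL-x x , replicate-reduced (suc n)

∷-replicate-reduced : ∀ {x y} n → x ≢ invL y → Reduced (y ∷ replicate n x)
∷-replicate-reduced zero    _   = tt
∷-replicate-reduced (suc n) x≢y = x≢y , replicate-reduced (suc n)

replicate-++-reduced : ∀ {x y w} n → y ≢ invL x → Reduced (y ∷ w) → Reduced (replicate n x ++ y ∷ w)
replicate-++-reduced         zero          _   r = r
replicate-++-reduced         (suc zero)    y≢x r = y≢x , r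
replicate-++-reduced {x = x} (suc (suc n)) y≢x r = x≢invL-x x , replicate-++-reduced (suc n) y≢x r

powers : Letter → ℕ → List (List Letter)
powers x n = map (λ d → replicate d x) (upTo n) ++ map (λ d → replicate d (invL x)) (upTo n)

length-powers : ∀ x n → length (powers x n) ≡ n + n
length-powers x n = begin
  length (powers x n)                                   ≡⟨ ListP.length-++ (map (λ d → replicate d x) (upTo n)) ⟩
  length (map _ (upTo n)) + length (map _ (upTo n))     ≡⟨ cong₂ _+_ (ListP.length-map _ (upTo n)) (ListP.length-map _ (upTo n)) ⟩
  length (upTo n) + length (upTo n)                     ≡⟨ cong₂ _+_ (ListP.length-upTo n) (ListP.length-upTo n) ⟩
  n + n                                                 ∎
  where open ≡-Reasoning

difference-∈-powers : ∀ x {n i j} → i < n → j < n →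
  replicate (i ∸ j) x ++ replicate (j ∸ i) (invL x) ∈ powers x n
difference-∈-powers x {n} {i} {j} i<n j<n with ≤-total j i
... | inj₁ j≤i rewrite m≤n⇒m∸n≡0 j≤i | ListP.++-identityʳ (replicate (i ∸ j) x) =
  ∈-++⁺ˡ (∈-map⁺ (λ d → replicate d x) (∈-upTo⁺ (≤-<-trans (m∸n≤m i j) i<n)))
... | inj₂ i≤j rewrite m≤n⇒m∸n≡0 i≤j =
  ∈-++⁺ʳ (map (λ d → replicate d x) (upTo n)) (∈-map⁺ (λ d → replicate d (invL x)) (∈-upTo⁺ (≤-<-trans (m∸n≤m j i) j<n)))

framedPowers : List (List Letter) → Letter → ℕ → List (List Letter)
framedPowers H x n = cartesianProductWith (λ (u , v) w → reduce (u ++ w ++ inv v)) (cartesianProduct H H) (powers x n)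

length-framedPowers : ∀ H x n → length (framedPowers H x n) ≡ (length H * length H) * (n + n)
length-framedPowers H x n = begin
  length (framedPowers H x n)                         ≡⟨ length-cartesianProductWith _ (cartesianProduct H H) (powers x n) ⟩
  length (cartesianProduct H H) * length (powers x n) ≡⟨ cong₂ _*_ (length-cartesianProductWith _,_ H H) (length-powers x n) ⟩
  (length H * length H) * (n + n)                     ∎
  where open ≡-Reasoning

quotient-∈-framedPowers : ∀ {H x n u v i j} → u ∈ H → v ∈ H → i < n → j < n →
  mul (u ++ replicate i x) (inv (v ++ replicate j x)) ∈ framedPowers H x n
quotient-∈-framedPowers {H} {x} {n} {u} {v} {i} {j} u∈H v∈H i<n j<n =
  subst (_∈ framedPowers H x n) (sym quotient-reduces)
    (∈-cartesianProductWith⁺ _ (∈-cartesianProduct⁺ u∈H v∈H) (difference-∈-powers x i<n j<n))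
  where
  open ≡-Reasoning
  xⁱ⁻ʲ : List Letter
  xⁱ⁻ʲ = replicate (i ∸ j) x ++ replicate (j ∸ i) (invL x)
  quotient-reduces : mul (u ++ replicate i x) (inv (v ++ replicate j x)) ≡ reduce (u ++ xⁱ⁻ʲ ++ inv v)
  quotient-reduces = begin
    reduce ((u ++ replicate i x) ++ inv (v ++ replicate j x))
      ≡⟨ cong (λ t → reduce ((u ++ replicate i x) ++ t)) (inv-++ v (replicate j x)) ⟩
    reduce ((u ++ replicate i x) ++ inv (replicate j x) ++ inv v)
      ≡⟨ cong (λ t → reduce ((u ++ replicate i x) ++ t ++ inv v)) (inv-replicate j x) ⟩
    reduce ((u ++ replicate i x) ++ replicate j (invL x) ++ inv v)
      ≡⟨ cong reduce (ListP.++-assoc u (replicate i x) _) ⟩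
    reduce (u ++ replicate i x ++ replicate j (invL x) ++ inv v)
      ≡⟨ reduce-++-congʳ u (reduce-powers x i j (inv v)) ⟩
    reduce (u ++ replicate (i ∸ j) x ++ replicate (j ∸ i) (invL x) ++ inv v)
      ≡⟨ cong (λ t → reduce (u ++ t)) (ListP.++-assoc (replicate (i ∸ j) x) _ (inv v)) ⟨
    reduce (u ++ xⁱ⁻ʲ ++ inv v) ∎

a b : Letter
a = (zero , true)
b = (suc zero , true)

prefixes : List (List Letter)
prefixes = [] ∷ (b ∷ []) ∷ []

unbalancedSet : ℕ → ℕ → List (List Letter)
unbalancedSet k m = map (λ i → replicate i a) (upTo k) ++ map (λ j → b ∷ replicate j a) (upTo m)

∈-unbalancedSet⁻ : ∀ k m {w} → w ∈ unbalancedSet k m →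
  ∃[ u ] ∃[ i ] u ∈ prefixes × i < k + m × w ≡ u ++ replicate i a
∈-unbalancedSet⁻ k m w∈ with ∈-++⁻ (map (λ i → replicate i a) (upTo k)) w∈
... | inj₁ w∈aⁱ with ∈-map⁻ (λ i → replicate i a) w∈aⁱ
...   | i , i∈ , w≡ = [] , i , ∈-lookup zero , ≤-trans (∈-upTo⁻ i∈) (m≤m+n k m) , w≡
∈-unbalancedSet⁻ k m w∈ | inj₂ w∈baʲ with ∈-map⁻ (λ j → b ∷ replicate j a) w∈baʲ
...   | j , j∈ , w≡ = b ∷ [] , j , ∈-lookup (suc zero) , ≤-trans (∈-upTo⁻ j∈) (m≤n+m m k) , w≡

rightQuot-unbalancedSet : ∀ k m → rightQuot (unbalancedSet k m) ≤ 4 * ((k + m) + (k + m))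
rightQuot-unbalancedSet k m = ≤-trans (length-deduplicate-⊆ _≟W_ quotients⊆)
  (≤-reflexive (length-framedPowers prefixes a (k + m)))
  where
  quotients⊆ : cartesianProductWith (λ x y → mul x (inv y)) (unbalancedSet k m) (unbalancedSet k m)
               ⊆ framedPowers prefixes a (k + m)
  quotients⊆ z∈ with ∈-cartesianProductWith⁻ _ (unbalancedSet k m) (unbalancedSet k m) z∈
  ... | x , y , x∈ , y∈ , refl with ∈-unbalancedSet⁻ k m x∈ | ∈-unbalancedSet⁻ k m y∈
  ... | u , i , u∈ , i< , refl | v , j , v∈ , j< , refl = quotient-∈-framedPowers u∈ v∈ i< j<

mixedWord : ℕ → ℕ → List Letter
mixedWord i j = replicate i (invL a) ++ b ∷ replicate j a

mixedWord-injective : ∀ {i j i' j'} → mixedWord i j ≡ mixedWord i' j' → i ≡ i' × j ≡ j'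
mixedWord-injective {i} {_} {i'} eq with replicate-++-injective i i' (λ ()) eq
... | i≡i' , aʲ≡aʲ' = i≡i' , replicate-injective a aʲ≡aʲ'

mixedWord-quotient : ∀ i j → mul (inv (replicate i a)) (b ∷ replicate j a) ≡ mixedWord i j
mixedWord-quotient i j = begin
  reduce (inv (replicate i a) ++ b ∷ replicate j a) ≡⟨ cong (λ t → reduce (t ++ b ∷ replicate j a)) (inv-replicate i a) ⟩
  reduce (mixedWord i j)                           ≡⟨ reduce-reduced-id (mixedWord i j) mixedWord-reduced ⟩
  mixedWord i j                                    ∎
  where
  open ≡-Reasoning
  mixedWord-reduced : Reduced (mixedWord i j)
  mixedWord-reduced = replicate-++-reduced i (λ ()) (∷-replicate-reduced j (λ ()))

leftQuot-unbalancedSet : ∀ k m → k * m ≤ leftQuot (unbalancedSet k m)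
leftQuot-unbalancedSet k m = begin
  k * m                                                     ≡⟨ cong₂ _*_ (ListP.length-upTo k) (ListP.length-upTo m) ⟨
  length (upTo k) * length (upTo m)                         ≡⟨ length-cartesianProductWith mixedWord (upTo k) (upTo m) ⟨
  length (cartesianProductWith mixedWord (upTo k) (upTo m)) ≤⟨ Unique-⊆⇒length≤deduplicate _≟W_ mixedWords-unique mixedWords⊆ ⟩
  leftQuot (unbalancedSet k m)                              ∎
  where
  open ≤-Reasoning
  mixedWords-unique : Unique (cartesianProductWith mixedWord (upTo k) (upTo m))
  mixedWords-unique = Unique.cartesianProductWith⁺ mixedWord mixedWord-injective (Unique.upTo⁺ k) (Unique.upTo⁺ m)
  mixedWords⊆ : cartesianProductWith mixedWord (upTo k) (upTo m)
                ⊆ cartesianProductWith (λ x y → mul (inv x) y) (unbalancedSet k m) (unbalancedSet k m)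
  mixedWords⊆ z∈ with ∈-cartesianProductWith⁻ mixedWord (upTo k) (upTo m) z∈
  ... | i , j , i∈ , j∈ , refl = subst (_∈ _) (mixedWord-quotient i j)
    (∈-cartesianProductWith⁺ (λ x y → mul (inv x) y)
      (∈-++⁺ˡ (∈-map⁺ (λ i → replicate i a) i∈))
      (∈-++⁺ʳ (map (λ i → replicate i a) (upTo k)) (∈-map⁺ (λ j → b ∷ replicate j a) j∈)))

replicate≢∷replicate : ∀ i j → replicate i a ≢ b ∷ replicate j a
replicate≢∷replicate zero    j ()
replicate≢∷replicate (suc i) j ()

unbalancedSubset : ∀ {n} k m → k + m ≡ n → FinSubset n
unbalancedSubset k m k+m≡n = record
  { elems   = unbalancedSet k m
  ; reduced = AllP.++⁺ (AllP.map⁺ (All.universal replicate-reduced (upTo k)))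
                       (AllP.map⁺ (All.universal (λ j → ∷-replicate-reduced j (λ ())) (upTo m)))
  ; unique  = Unique.++⁺ (Unique.map⁺ (replicate-injective a) (Unique.upTo⁺ k))
                         (Unique.map⁺ (λ eq → replicate-injective a (ListP.∷-injectiveʳ eq)) (Unique.upTo⁺ m))
                         halves-disjoint
  ; size    = begin
      length (unbalancedSet k m)                                         ≡⟨ ListP.length-++ (map (λ i → replicate i a) (upTo k)) ⟩
      length (map _ (upTo k)) + length (map _ (upTo m))                  ≡⟨ cong₂ _+_ (ListP.length-map _ (upTo k)) (ListP.length-map _ (upTo m)) ⟩
      length (upTo k) + length (upTo m)                                  ≡⟨ cong₂ _+_ (ListP.length-upTo k) (ListP.length-upTo m) ⟩
      k + m                                                              ≡⟨ k+m≡n ⟩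
      _                                                                  ∎
  }
  where
  open ≡-Reasoning
  halves-disjoint : ∀ {w} → ¬ (w ∈ map (λ i → replicate i a) (upTo k) × w ∈ map (λ j → b ∷ replicate j a) (upTo m))
  halves-disjoint (w∈aⁱ , w∈baʲ) with ∈-map⁻ _ w∈aⁱ | ∈-map⁻ _ w∈baʲ
  ... | i , _ , refl | j , _ , eq = replicate≢∷replicate i j eq

near-halves-bound : ∀ {k m} → 32 ≤ k → k ≤ m → m ≤ suc k →
  (k + m) * (k + m) + 16 * (4 * ((k + m) + (k + m))) ≤ 16 * (k * m)
near-halves-bound {k} {m} 32≤k k≤m m≤1+k = begin
  (k + m) * (k + m) + 16 * (4 * ((k + m) + (k + m))) ≤⟨ +-mono-≤ square-bound linear-bound ⟩
  8 * (k * m) + 8 * (k * m)                          ≡⟨ +-double (k * m) ⟩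
  16 * (k * m)                                       ∎
  where
  open ≤-Reasoning
  +-double : ∀ x → 8 * x + 8 * x ≡ 16 * x
  +-double = solve-∀
  square-double : ∀ x → (x + x) * (x + x) ≡ 4 * (x * x)
  square-double = solve-∀
  mixed-double : ∀ x y → 4 * (y * (x + x)) ≡ 8 * (x * y)
  mixed-double = solve-∀
  linear-double : ∀ x → 16 * (4 * ((x + x) + (x + x))) ≡ 8 * (32 * x)
  linear-double = solve-∀
  k+m≤m+m : k + m ≤ m + m
  k+m≤m+m = +-monoˡ-≤ m k≤m
  square-bound : (k + m) * (k + m) ≤ 8 * (k * m)
  square-bound = begin
    (k + m) * (k + m)   ≤⟨ *-mono-≤ k+m≤m+m k+m≤m+m ⟩
    (m + m) * (m + m)   ≡⟨ square-double m ⟩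
    4 * (m * m)         ≤⟨ *-monoʳ-≤ 4 (*-monoʳ-≤ m (≤-trans m≤1+k (+-monoˡ-≤ k (≤-trans (s≤s z≤n) 32≤k)))) ⟩
    4 * (m * (k + k))   ≡⟨ mixed-double k m ⟩
    8 * (k * m)         ∎
  linear-bound : 16 * (4 * ((k + m) + (k + m))) ≤ 8 * (k * m)
  linear-bound = begin
    16 * (4 * ((k + m) + (k + m))) ≤⟨ *-monoʳ-≤ 16 (*-monoʳ-≤ 4 (+-mono-≤ k+m≤m+m k+m≤m+m)) ⟩
    16 * (4 * ((m + m) + (m + m))) ≡⟨ linear-double m ⟩
    8 * (32 * m)                   ≤⟨ *-monoʳ-≤ 8 (*-monoˡ-≤ m 32≤k) ⟩
    8 * (k * m)                    ∎

unbalancedSet-quotDiff : ∀ {k m} → 32 ≤ k → k ≤ m → m ≤ suc k →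
  (k + m) * (k + m) ≤ 16 * ∣ rightQuot (unbalancedSet k m) - leftQuot (unbalancedSet k m) ∣
unbalancedSet-quotDiff {k} {m} 32≤k k≤m m≤1+k = begin
  (k + m) * (k + m) ≤⟨ m+n≤o⇒m≤o∸n ((k + m) * (k + m)) square+16R≤16L ⟩
  16 * L ∸ 16 * R   ≡⟨ *-distribˡ-∸ 16 L R ⟨
  16 * (L ∸ R)      ≤⟨ *-monoʳ-≤ 16 (m∸n≤∣m-n∣ L R) ⟩
  16 * ∣ L - R ∣    ≡⟨ cong (16 *_) (∣-∣-comm L R) ⟩
  16 * ∣ R - L ∣    ∎
  where
  open ≤-Reasoning
  L R : ℕ
  L = leftQuot (unbalancedSet k m)
  R = rightQuot (unbalancedSet k m)
  square+16R≤16L : (k + m) * (k + m) + 16 * R ≤ 16 * L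
  square+16R≤16L = begin
    (k + m) * (k + m) + 16 * R                          ≤⟨ +-monoʳ-≤ ((k + m) * (k + m)) (*-monoʳ-≤ 16 (rightQuot-unbalancedSet k m)) ⟩
    (k + m) * (k + m) + 16 * (4 * ((k + m) + (k + m)))  ≤⟨ near-halves-bound 32≤k k≤m m≤1+k ⟩
    16 * (k * m)                                        ≤⟨ *-monoʳ-≤ 16 (leftQuot-unbalancedSet k m) ⟩
    16 * L                                              ∎

⌈n/2⌉≤1+⌊n/2⌋ : ∀ n → ⌈ n /2⌉ ≤ suc ⌊ n /2⌋
⌈n/2⌉≤1+⌊n/2⌋ zero          = z≤n
⌈n/2⌉≤1+⌊n/2⌋ (suc zero)    = s≤s z≤n
⌈n/2⌉≤1+⌊n/2⌋ (suc (suc n)) = s≤s (⌈n/2⌉≤1+⌊n/2⌋ n)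

halvesSubset : ∀ n → FinSubset n
halvesSubset n = unbalancedSubset ⌊ n /2⌋ ⌈ n /2⌉ (⌊n/2⌋+⌈n/2⌉≡n n)

halvesSubset-quotDiff : ∀ n → 64 ≤ n → n * n ≤ 16 * quotDiff (halvesSubset n)
halvesSubset-quotDiff n 64≤n =
  subst (λ t → t * t ≤ 16 * quotDiff (halvesSubset n)) (⌊n/2⌋+⌈n/2⌉≡n n)
    (unbalancedSet-quotDiff (⌊n/2⌋-mono 64≤n) (⌊n/2⌋≤⌈n/2⌉ n) (⌈n/2⌉≤1+⌊n/2⌋ n))

quotDiff≤square : ∀ {n} (A : FinSubset n) → quotDiff A ≤ n * n
quotDiff≤square {n} A =
  ≤-trans (∣m-n∣≤m⊔n (rightQuot elems) (leftQuot elems)) (⊔-lub (quotients≤square (λ x y → mul x (inv y))) (quotients≤square (λ x y → mul (inv x) y)))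
  where
  open FinSubset A
  quotients≤square : ∀ f → card (cartesianProductWith f elems elems) ≤ n * n
  quotients≤square f = ≤-trans (ListP.length-deduplicate _≟W_ (cartesianProductWith f elems elems))
    (≤-reflexive (trans (length-cartesianProductWith f elems elems) (cong₂ _*_ size size)))

1*n^2≡n*n : ∀ n → 1 * n ^ 2 ≡ n * n
1*n^2≡n*n n = trans (*-identityˡ (n ^ 2)) (cong (n *_) (*-identityʳ n))

proposition2p6 : (M : ℕ → ℕ) → (∀ n → .{{_ : NonZero n}} → IsSupQuotDiff n (M n)) →
    ∃[ p ] ∃[ q ] ∃[ C ] ∃[ N ] (NonZero p × NonZero q ×
      (∀ n → N ≤ n → (p * n ^ 2 ≤ q * M n) × (M n ≤ C * n ^ 2)))
proposition2p6 M isSup = 1 , 16 , 1 , 64 , _ , _ , bounds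
  where
  bounds : ∀ n → 64 ≤ n → (1 * n ^ 2 ≤ 16 * M n) × (M n ≤ 1 * n ^ 2)
  bounds n 64≤n = lower , upper
    where
    open ≤-Reasoning
    sup : IsSupQuotDiff n (M n)
    sup = isSup n {{>-nonZero (≤-trans (s≤s z≤n) 64≤n)}}
    lower : 1 * n ^ 2 ≤ 16 * M n
    lower = begin
      1 * n ^ 2                       ≡⟨ 1*n^2≡n*n n ⟩
      n * n                           ≤⟨ halvesSubset-quotDiff n 64≤n ⟩
      16 * quotDiff (halvesSubset n)  ≤⟨ *-monoʳ-≤ 16 (proj₁ sup (halvesSubset n)) ⟩
      16 * M n                        ∎
    upper : M n ≤ 1 * n ^ 2
    upper = proj₂ sup (1 * n ^ 2) (λ A → subst (quotDiff A ≤_) (sym (1*n^2≡n*n n)) (quotDiff≤square A))
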